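{- Let $v$ be prime, $1\le\ell\le w\le v$, and let $G_\ell:[v]^\ell\to[v]^w$ be a function such that for all $y\ne y'$, $d_H(G_\ell(y),G_\ell(y'))\ge w-\ell$, and for $y\in_u[v]^\ell$, $G_\ell(y)$ is $\ell$-wise independent. Let $\mathcal{RS}=\{G_\ell(y):y\in[v]^\ell\}$. Then the collection of partitions $\{P^\alpha:\alpha\in\mathcal{RS}\}$ of $[vw]$ is a $(w-\ell)$-design.
   Context: Shift-Hamming distance: for $x,x'\in[B]^m$, $d_H(x,x')=\min_{a\in[B]}|\{i\in[m]: x_i-x'_i\ne a \bmod B\}|$. For $\alpha\in[v]^w$, the partition $P^\alpha=\{P^\alpha_1,\ldots,P^\alpha_v\}$ of $[n]=[vw]$ into $w$-sized blocks is $P^\alpha_i=\{(k-1)v+((i-\alpha_k)\bmod v): k\in[w]\}$ (residues mod $v$ taken in $[v]$). A collection of partitions $\{P^\alpha\}$ of $[n]$ into $w$-sized blocks is a $d$-design if for all distinct $\alpha,\beta$ in the index set and all $i,j\in[v]$, $|P^\alpha_i\cap P^\beta_j|\le w-d$. -}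

module Defs where

open import Data.Nat using (ℕ; zero; suc; _+_; _*_; _∸_; _⊓_; _^_; _≤_)
open import Data.Nat.DivMod using (_mod_)
open import Data.Fin using (Fin; zero; suc; toℕ; combine)
open import Data.Fin.Subset using (Subset; ⋃; ⁅_⁆; ∣_∣; _∩_)
open import Data.Fin.Properties using () renaming (_≟_ to _≟ᶠ_)
open import Data.Bool using (Bool; true; false)
open import Data.List using (List; []; _∷_; map; concatMap; allFin; length; filter)
open import Data.Vec using (Vec; []; _∷_; lookup; tabulate)
open import Data.Vec.Properties using (≡-dec)
open import Data.Product using (∃; _×_)
open import Relation.Binary.PropositionalEquality using (_≡_; _≢_)
open import Relation.Nullary using (Dec; yes; no; ¬?)

-- [B] is modelled as Fin B (residues 0,…,B-1).

_⊖_ : ∀ {B} → Fin B → Fin B → Fin B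
_⊖_ {suc B} x y = (toℕ x + (suc B ∸ toℕ y)) mod (suc B)

mismatch : ∀ {B m} → Vec (Fin B) m → Vec (Fin B) m → Fin B → ℕ
mismatch {m = m} x x' a =
  length (filter (λ i → ¬? ((lookup x i ⊖ lookup x' i) ≟ᶠ a)) (allFin m))

minFin : ∀ {B} → (Fin (suc B) → ℕ) → ℕ
minFin {zero} f = f zero
minFin {suc B} f = f zero ⊓ minFin (λ a → f (suc a))

-- shift-Hamming distance d_H(x,x') = min_a |{i : x_i - x'_i ≠ a mod B}|
-- (for B = 0 there is no vector unless m = 0; we set it to 0 there)
dH : ∀ {B m} → Vec (Fin B) m → Vec (Fin B) m → ℕ
dH {zero} x x' = 0
dH {suc B} x x' = minFin (mismatch x x')

allVecs : ∀ v ℓ → List (Vec (Fin v) ℓ)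
allVecs v zero = [] ∷ []
allVecs v (suc ℓ) = concatMap (λ a → map (a ∷_) (allVecs v ℓ)) (allFin v)

restrict : ∀ {A : Set} {w ℓ} → (Fin ℓ → Fin w) → Vec A w → Vec A ℓ
restrict ι x = tabulate (λ j → lookup x (ι j))

countSeeds : ∀ {v ℓ w} → (Vec (Fin v) ℓ → Vec (Fin v) w) →
             (ι : Fin ℓ → Fin w) → Vec (Fin v) ℓ → ℕ
countSeeds {v} {ℓ} G ι t =
  length (filter (λ y → ≡-dec _≟ᶠ_ (restrict ι (G y)) t) (allVecs v ℓ))

Injective : ∀ {a b} → (Fin a → Fin b) → Set
Injective f = ∀ i j → f i ≡ f j → i ≡ j

-- For y uniform in [v]^ℓ, G(y) is ℓ-wise independent: for every choice of
-- ℓ distinct coordinates and every target t ∈ [v]^ℓ,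
-- Pr_y[G(y)|_ι = t] = v^(-ℓ), i.e. #{y : G(y)|_ι = t} · v^ℓ = |[v]^ℓ| (= v^ℓ).
LWiseIndependent : ∀ {v ℓ w} → (Vec (Fin v) ℓ → Vec (Fin v) w) → Set
LWiseIndependent {v} {ℓ} {w} G =
  (ι : Fin ℓ → Fin w) → Injective ι → (t : Vec (Fin v) ℓ) →
  countSeeds G ι t * (v ^ ℓ) ≡ length (allVecs v ℓ)

-- P^α_i = { k·v + ((i - α_k) mod v) : k ∈ [w] } ⊆ [w·v]  (0-based version of
-- (k-1)v + ((i-α_k) mod v)); combine k r = k * v + r.
P : ∀ {v w} → Vec (Fin v) w → Fin v → Subset (w * v)
P {v} {w} α i = ⋃ (map (λ k → ⁅ combine k (i ⊖ lookup α k) ⁆) (allFin w))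

IsDesign : ∀ {v w} → (Vec (Fin v) w → Set) → ℕ → Set
IsDesign {v} {w} S d =
  ∀ α β → S α → S β → α ≢ β → (i j : Fin v) →
  ∣ P α i ∩ P β j ∣ ≤ w ∸ d

InImage : ∀ {v ℓ w} → (Vec (Fin v) ℓ → Vec (Fin v) w) → Vec (Fin v) w → Set
InImage G α = ∃ λ y → α ≡ G y

-- The block P^α_i meets column k of the v × w grid in row i − α_k, so P^α_i and
-- P^β_j share the cell of column k exactly when α_k − β_k ≡ i − j (mod v).
-- Hence |P^α_i ∩ P^β_j| is at most the number of coordinates on which α − β
-- equals the shift i − j, i.e. w minus the number of mismatches for that shift,
-- which is at most w − d_H(α, β) ≤ w − (w − ℓ) for distinct codewords α, β.
module Submission where

open import Defs
open import Data.Nat using (ℕ; _≤_; _∸_)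
open import Data.Nat.Primality using (Prime)
open import Data.Fin using (Fin)
open import Data.Vec using (Vec)
open import Relation.Binary.PropositionalEquality using (_≢_)

open import Data.Nat using (zero; suc; _+_; _*_; _%_; z≤n; s≤s)
open import Data.Nat.Properties
  using (≤-trans; ≤-refl; +-suc; +-assoc; +-comm; +-monoʳ-≤; +-monoˡ-≤; n≤1+n;
         m⊓n≤m; m⊓n≤n; m∸n+n≡m; m+n≤o⇒m≤o∸n; ∸-monoʳ-≤; <⇒≤)
open import Data.Nat.DivMod using (%-distribˡ-+; [m+n]%n≡m%n)
open import Data.Fin using (toℕ; combine)
open import Data.Fin.Properties using (toℕ-fromℕ<; toℕ-injective; combine-injective; toℕ<n)
  renaming (_≟_ to _≟ᶠ_)
open import Data.Fin.Subset using (Subset; ⋃; ⁅_⁆; ∣_∣; _∩_; _∪_; _∈_; _⊆_)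
open import Data.Fin.Subset.Properties
  using (x∈⁅x⁆; x∈⁅y⁆⇒x≡y; p⊆q⇒∣p∣≤∣q∣; x∈p∩q⁻; x∈p∪q⁺; x∈p∪q⁻; ∣⁅x⁆∣≡1; ∣⊥∣≡0; ∉⊥)
open import Data.Bool using (true; false)
open import Data.List using (List; []; _∷_; map; allFin; length; filter)
open import Data.List.Properties using (length-tabulate)
open import Data.List.Membership.Propositional using () renaming (_∈_ to _∈ˡ_)
open import Data.List.Membership.Propositional.Properties using (∈-allFin; ∈-filter⁺)
open import Data.List.Relation.Unary.Any using (here; there)
open import Data.Vec using ([]; _∷_; lookup)
open import Data.Product using (∃; _,_)
open import Data.Sum using (inj₁; inj₂)
open import Relation.Binary.PropositionalEquality
  using (_≡_; refl; sym; trans; cong; module ≡-Reasoning)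
open import Relation.Nullary using (yes; no; ¬?; contradiction)
open import Relation.Unary using (Pred; Decidable)
open import Level using (0ℓ)

image : ∀ {n} {A : Set} → (A → Fin n) → List A → Subset n
image h xs = ⋃ (map (λ k → ⁅ h k ⁆) xs)

∣p∪q∣≤∣p∣+∣q∣ : ∀ {n} (p q : Subset n) → ∣ p ∪ q ∣ ≤ ∣ p ∣ + ∣ q ∣
∣p∪q∣≤∣p∣+∣q∣ []          []          = z≤n
∣p∪q∣≤∣p∣+∣q∣ (true ∷ p)  (true ∷ q)  = s≤s (≤-trans (∣p∪q∣≤∣p∣+∣q∣ p q) (+-monoʳ-≤ ∣ p ∣ (n≤1+n _)))
∣p∪q∣≤∣p∣+∣q∣ (true ∷ p)  (false ∷ q) = s≤s (∣p∪q∣≤∣p∣+∣q∣ p q)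
∣p∪q∣≤∣p∣+∣q∣ (false ∷ p) (true ∷ q) rewrite +-suc ∣ p ∣ ∣ q ∣ = s≤s (∣p∪q∣≤∣p∣+∣q∣ p q)
∣p∪q∣≤∣p∣+∣q∣ (false ∷ p) (false ∷ q) = ∣p∪q∣≤∣p∣+∣q∣ p q

∣image∣≤length : ∀ {n} {A : Set} (h : A → Fin n) (xs : List A) → ∣ image h xs ∣ ≤ length xs
∣image∣≤length {n} h [] rewrite ∣⊥∣≡0 n = z≤n
∣image∣≤length h (x ∷ xs) = begin
  ∣ ⁅ h x ⁆ ∪ image h xs ∣       ≤⟨ ∣p∪q∣≤∣p∣+∣q∣ ⁅ h x ⁆ (image h xs) ⟩
  ∣ ⁅ h x ⁆ ∣ + ∣ image h xs ∣   ≡⟨ cong (_+ ∣ image h xs ∣) (∣⁅x⁆∣≡1 (h x)) ⟩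
  suc ∣ image h xs ∣             ≤⟨ s≤s (∣image∣≤length h xs) ⟩
  suc (length xs)                ∎
  where open Data.Nat.Properties.≤-Reasoning

∈-image⁻ : ∀ {n} {A : Set} (h : A → Fin n) (xs : List A) {x} →
           x ∈ image h xs → ∃ λ k → x ≡ h k
∈-image⁻ h []       x∈ = contradiction x∈ ∉⊥
∈-image⁻ h (y ∷ xs) x∈ with x∈p∪q⁻ ⁅ h y ⁆ (image h xs) x∈
... | inj₁ x∈⁅hy⁆ = y , x∈⁅y⁆⇒x≡y (h y) x∈⁅hy⁆
... | inj₂ x∈img  = ∈-image⁻ h xs x∈img

∈-image⁺ : ∀ {n} {A : Set} (h : A → Fin n) {xs : List A} {k} → k ∈ˡ xs → h k ∈ image h xs
∈-image⁺ h (here refl) = x∈p∪q⁺ (inj₁ (x∈⁅x⁆ (h _)))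
∈-image⁺ h (there k∈)  = x∈p∪q⁺ (inj₂ (∈-image⁺ h k∈))

length-filter+length-filter¬ : ∀ {A : Set} {P : Pred A 0ℓ} (P? : Decidable P) (xs : List A) →
  length (filter P? xs) + length (filter (λ x → ¬? (P? x)) xs) ≡ length xs
length-filter+length-filter¬ P? [] = refl
length-filter+length-filter¬ P? (x ∷ xs) with P? x
... | yes _ = cong suc (length-filter+length-filter¬ P? xs)
... | no _  = trans (+-suc _ _) (cong suc (length-filter+length-filter¬ P? xs))

minFin≤ : ∀ {B} (f : Fin (suc B) → ℕ) a → minFin f ≤ f a
minFin≤ {zero}  f Fin.zero    = ≤-refl
minFin≤ {suc B} f Fin.zero    = m⊓n≤m _ _
minFin≤ {suc B} f (Fin.suc a) = ≤-trans (m⊓n≤n _ _) (minFin≤ (λ a → f (Fin.suc a)) a)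

dH≤mismatch : ∀ {B m} (x x' : Vec (Fin (suc B)) m) a → dH x x' ≤ mismatch x x' a
dH≤mismatch x x' = minFin≤ (mismatch x x')

module _ {B : ℕ} where
  private
    v : ℕ
    v = suc B

    diff : Fin v → Fin v → ℕ
    diff x y = toℕ x + (v ∸ toℕ y)

    toℕ-⊖ : (x y : Fin v) → toℕ (x ⊖ y) ≡ diff x y % v
    toℕ-⊖ x y = toℕ-fromℕ< _

    diff-telescope : (x y z : Fin v) → diff x y + diff y z ≡ diff x z + v
    diff-telescope x y z = begin
      toℕ x + (v ∸ toℕ y) + (toℕ y + (v ∸ toℕ z))   ≡⟨ +-assoc (toℕ x) _ _ ⟩
      toℕ x + ((v ∸ toℕ y) + (toℕ y + (v ∸ toℕ z))) ≡⟨ cong (toℕ x +_) (+-assoc (v ∸ toℕ y) _ _) ⟨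
      toℕ x + ((v ∸ toℕ y) + toℕ y + (v ∸ toℕ z))   ≡⟨ cong (λ t → toℕ x + (t + (v ∸ toℕ z))) (m∸n+n≡m (<⇒≤ (toℕ<n y))) ⟩
      toℕ x + (v + (v ∸ toℕ z))                     ≡⟨ cong (toℕ x +_) (+-comm v _) ⟩
      toℕ x + ((v ∸ toℕ z) + v)                     ≡⟨ +-assoc (toℕ x) _ _ ⟨
      toℕ x + (v ∸ toℕ z) + v                       ∎
      where open ≡-Reasoning

    %-congˡ-+ : ∀ m n o → m % v ≡ n % v → (m + o) % v ≡ (n + o) % v
    %-congˡ-+ m n o eq = begin
      (m + o) % v             ≡⟨ %-distribˡ-+ m o v ⟩
      (m % v + o % v) % v     ≡⟨ cong (λ t → (t + o % v) % v) eq ⟩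
      (n % v + o % v) % v     ≡⟨ %-distribˡ-+ n o v ⟨
      (n + o) % v             ∎
      where open ≡-Reasoning

  -- i − a ≡ j − b  ⇒  a − b ≡ i − j: add a − j to both sides and telescope.
  ⊖-swap : (i a j b : Fin v) → i ⊖ a ≡ j ⊖ b → a ⊖ b ≡ i ⊖ j
  ⊖-swap i a j b eq = toℕ-injective (begin
    toℕ (a ⊖ b)                  ≡⟨ toℕ-⊖ a b ⟩
    diff a b % v                 ≡⟨ [m+n]%n≡m%n (diff a b) v ⟨
    (diff a b + v) % v           ≡⟨ cong (_% v) (diff-telescope a j b) ⟨
    (diff a j + diff j b) % v    ≡⟨ cong (_% v) (+-comm (diff a j) _) ⟩
    (diff j b + diff a j) % v    ≡⟨ %-congˡ-+ (diff i a) (diff j b) (diff a j) diff-i-a≡diff-j-b ⟨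
    (diff i a + diff a j) % v    ≡⟨ cong (_% v) (diff-telescope i a j) ⟩
    (diff i j + v) % v           ≡⟨ [m+n]%n≡m%n (diff i j) v ⟩
    diff i j % v                 ≡⟨ toℕ-⊖ i j ⟨
    toℕ (i ⊖ j)                  ∎)
    where
    open ≡-Reasoning
    diff-i-a≡diff-j-b : diff i a % v ≡ diff j b % v
    diff-i-a≡diff-j-b = trans (sym (toℕ-⊖ i a)) (trans (cong toℕ eq) (toℕ-⊖ j b))

agreements : ∀ {B m} → Vec (Fin B) m → Vec (Fin B) m → Fin B → ℕ
agreements {m = m} x x' a =
  length (filter (λ k → (lookup x k ⊖ lookup x' k) ≟ᶠ a) (allFin m))

agreements+mismatch≡length : ∀ {B m} (x x' : Vec (Fin B) m) a →
  agreements x x' a + mismatch x x' a ≡ m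
agreements+mismatch≡length {m = m} x x' a =
  trans (length-filter+length-filter¬ (λ k → (lookup x k ⊖ lookup x' k) ≟ᶠ a) (allFin m))
        (length-tabulate (λ k → k))

∣P∩P∣≤agreements : ∀ {B w} (α β : Vec (Fin (suc B)) w) (i j : Fin (suc B)) →
  ∣ P α i ∩ P β j ∣ ≤ agreements α β (i ⊖ j)
∣P∩P∣≤agreements {w = w} α β i j =
  ≤-trans (p⊆q⇒∣p∣≤∣q∣ P∩P⊆image) (∣image∣≤length cell (filter agrees? (allFin w)))
  where
  cell : Fin w → Fin (w * _)
  cell k = combine k (i ⊖ lookup α k)
  agrees? : Decidable (λ k → (lookup α k ⊖ lookup β k) ≡ (i ⊖ j))
  agrees? k = (lookup α k ⊖ lookup β k) ≟ᶠ (i ⊖ j)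
  P∩P⊆image : P α i ∩ P β j ⊆ image cell (filter agrees? (allFin w))
  P∩P⊆image x∈ with x∈p∩q⁻ (P α i) (P β j) x∈
  ... | x∈Pαi , x∈Pβj with ∈-image⁻ cell (allFin w) x∈Pαi
                          | ∈-image⁻ (λ k → combine k (j ⊖ lookup β k)) (allFin w) x∈Pβj
  ... | k , refl | k' , same-cell with combine-injective k _ k' _ same-cell
  ... | refl , same-row =
    ∈-image⁺ cell (∈-filter⁺ agrees? (∈-allFin k) (⊖-swap i (lookup α k) j (lookup β k) same-row))

∣P∩P∣+dH≤w : ∀ {B w} (α β : Vec (Fin (suc B)) w) (i j : Fin (suc B)) →
  ∣ P α i ∩ P β j ∣ + dH α β ≤ w
∣P∩P∣+dH≤w {w = w} α β i j = begin
  ∣ P α i ∩ P β j ∣ + dH α β                        ≤⟨ +-monoˡ-≤ _ (∣P∩P∣≤agreements α β i j) ⟩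
  agreements α β (i ⊖ j) + dH α β                   ≤⟨ +-monoʳ-≤ _ (dH≤mismatch α β (i ⊖ j)) ⟩
  agreements α β (i ⊖ j) + mismatch α β (i ⊖ j)    ≡⟨ agreements+mismatch≡length α β (i ⊖ j) ⟩
  w                                                 ∎
  where open Data.Nat.Properties.≤-Reasoning

lemma7p1 : (v ℓ w : ℕ) → Prime v → 1 ≤ ℓ → ℓ ≤ w → w ≤ v →
    (G : Vec (Fin v) ℓ → Vec (Fin v) w) →
    (∀ y y' → y ≢ y' → w ∸ ℓ ≤ dH (G y) (G y')) →
    LWiseIndependent G →
    IsDesign (InImage G) (w ∸ ℓ)
lemma7p1 (suc B) ℓ w _ _ _ _ G distance _ α β (y , refl) (y' , refl) α≢β i j =
  ≤-trans (m+n≤o⇒m≤o∸n _ (∣P∩P∣+dH≤w α β i j)) (∸-monoʳ-≤ w (distance y y' y≢y'))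
  where
  y≢y' : y ≢ y'
  y≢y' refl = α≢β refl
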